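{- Let $H\in\mathcal{H}^+$ be a positive-Horn expression, let $h$ be any positive occurrence (an occurrence of an element of $\mathcal{L}\cup\{\bot\}$ not under an overline) in $H$, and let $\Delta(H,h)$ be its associated expression. Then for every interpretation $I$, $$H^I\models \big(\textstyle\bigvee(h\ \ \Delta(H,h))\big)^I .$$
   Context: Fix a set $\mathcal{A}$ of propositional atoms; $\mathcal{L}=\mathcal{A}\cup\{\neg a:a\in\mathcal{A}\}$ is the set of literals; for $\ell\in\mathcal{L}$, $\mathit{not}\,\ell$ is a default literal. Elementary expressions: $\mathcal{E}^1=\mathcal{L}\cup\{\mathit{not}\,\ell:\ell\in\mathcal{L}\}\cup\{\top,\bot\}$. For each $x\in\mathcal{E}^1$ there is a negative (overlined) elementary expression $\overline{x}$. Expressions are built from elementary and overlined elementary expressions with the connectives $\bigwedge[\varphi_1\ldots\varphi_k]$ and $\bigvee(\varphi_1\ldots\varphi_k)$. An interpretation is a set $I\subseteq\mathcal{L}$ containing no pair $a,\neg a$. Satisfaction: $I\models\top$, $I\not\models\bot$; $I\models\ell$ iff $\ell\in I$; $I\models\mathit{not}\,\ell$ iff $\ell\notin I$; $I\models\overline{x}$ iff $I\not\models x$; $I\models\bigwedge[\ldots]$ iff $I$ satisfies all conjuncts; $I\models\bigvee(\ldots)$ iff $I$ satisfies some disjunct. Reduct w.r.t. $I$: $x^I=x$ for $x\in\mathcal{L}\cup\{\top,\bot\}$; $(\mathit{not}\,\ell)^I=\bot$ if $\ell\in I$ and $\top$ otherwise; $(\overline{x})^I=\overline{x^I}$; reducts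 commute with $\bigwedge,\bigvee$. For expressions $\varphi,\psi$ without default literals, $\varphi\models\psi$ means every interpretation satisfying $\varphi$ satisfies $\psi$. Positive elements are the members of $\mathcal{L}\cup\{\bot\}$. $\mathcal{N}$ is the set of fully negative expressions: those built by $\bigwedge,\bigvee$ in which every elementary occurrence is overlined. The class $\mathcal{H}^+$ of positive-Horn expressions is the smallest set such that: (1) $\mathcal{L}\cup\{\bot\}\subseteq\mathcal{H}^+$; (2) if $\varphi_1,\ldots,\varphi_k\in\mathcal{H}^+$ then $\bigwedge[\varphi_1\ldots\varphi_k]\in\mathcal{H}^+$; (3) if for some $i$, $\varphi_i\in\mathcal{H}^+$ and $\varphi_j\in\mathcal{N}$ for all $j\neq i$, then $\bigvee(\varphi_1\ldots\varphi_k)\in\mathcal{H}^+$. For $H\in\mathcal{H}^+$ and a fixed positive occurrence $h$ in $H$, $\Delta(H,h)$ is defined recursively: if $H$ is this occurrence itself, $\Delta(H,h)=\bot$; if $H=\bigwedge[H_1\ldots H_k]$ and the occurrence lies in $H_i$, $\Delta(H,h)=\Delta(H_i,h)$; if $H=\bigvee(H_1\ldots H_k)$ and the occurrence lies in $H_i$, $\Delta(H,h)=\bigvee(H_1\ldots H_{i-1}\ \Delta(H_i,h)\ H_{i+1}\ldots H_k)$. -}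

module Defs where

open import Data.Bool using (Bool; true; false; not; T)
open import Data.Empty using (⊥)
open import Data.Unit using (⊤)
open import Data.List using (List; []; _∷_; _++_)
open import Data.List.Relation.Unary.All using (All)
open import Data.List.Relation.Unary.Any using (Any; here; there)
open import Data.Product using (_×_)
open import Data.Sum using (_⊎_)
open import Relation.Binary.PropositionalEquality using (_≡_)
open import Relation.Nullary using (¬_)

data Lit (A : Set) : Set where
  pos : A → Lit A
  neg : A → Lit A

data Elem (A : Set) : Set where
  lit  : Lit A → Elem A
  dnot : Lit A → Elem A      -- default literal  not ℓ
  top  : Elem A
  bot  : Elem A

data Expr (A : Set) : Set where
  el  : Elem A → Expr A
  ov  : Elem A → Expr A      -- overlined elementary expression
  and : List (Expr A) → Expr A
  or  : List (Expr A) → Expr A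

record Interp (A : Set) : Set where
  field
    val        : Lit A → Bool
    consistent : ∀ a → val (pos a) ≡ true → val (neg a) ≡ true → ⊥
open Interp public

SatE : {A : Set} → Interp A → Elem A → Set
SatE I (lit ℓ)  = T (val I ℓ)
SatE I (dnot ℓ) = T (not (val I ℓ))
SatE I top      = ⊤
SatE I bot      = ⊥

mutual
  Sat : {A : Set} → Interp A → Expr A → Set
  Sat I (el x)   = SatE I x
  Sat I (ov x)   = ¬ SatE I x
  Sat I (and φs) = SatAll I φs
  Sat I (or φs)  = SatAny I φs

  SatAll : {A : Set} → Interp A → List (Expr A) → Set
  SatAll I []       = ⊤
  SatAll I (φ ∷ φs) = Sat I φ × SatAll I φs

  SatAny : {A : Set} → Interp A → List (Expr A) → Set
  SatAny I []       = ⊥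
  SatAny I (φ ∷ φs) = Sat I φ ⊎ SatAny I φs

reductE : {A : Set} → Interp A → Elem A → Elem A
reductE I (lit ℓ)  = lit ℓ
reductE I (dnot ℓ) with val I ℓ
... | true  = bot
... | false = top
reductE I top = top
reductE I bot = bot

mutual
  reduct : {A : Set} → Interp A → Expr A → Expr A
  reduct I (el x)   = el (reductE I x)
  reduct I (ov x)   = ov (reductE I x)
  reduct I (and φs) = and (reductList I φs)
  reduct I (or φs)  = or (reductList I φs)

  reductList : {A : Set} → Interp A → List (Expr A) → List (Expr A)
  reductList I []       = []
  reductList I (φ ∷ φs) = reduct I φ ∷ reductList I φs

-- Entailment φ ⊨ ψ: every interpretation satisfying φ satisfies ψ.
-- (Only applied to reducts, which contain no default literals.)
_⊨_ : {A : Set} → Expr A → Expr A → Set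
_⊨_ {A} φ ψ = (J : Interp A) → Sat J φ → Sat J ψ

data PosElem {A : Set} : Elem A → Set where
  pl : (ℓ : Lit A) → PosElem (lit ℓ)
  pb : PosElem bot

data FullyNeg {A : Set} : Expr A → Set where
  nov : (x : Elem A) → FullyNeg (ov x)
  nand : {φs : List (Expr A)} → All FullyNeg φs → FullyNeg (and φs)
  nor  : {φs : List (Expr A)} → All FullyNeg φs → FullyNeg (or φs)

data HornPos {A : Set} : Expr A → Set where
  hpos : {x : Elem A} → PosElem x → HornPos (el x)
  hand : {φs : List (Expr A)} → All HornPos φs → HornPos (and φs)
  hor  : {pre post : List (Expr A)} {φ : Expr A} →
         All FullyNeg pre → HornPos φ → All FullyNeg post →
         HornPos (or (pre ++ φ ∷ post))

data Occ {A : Set} : Expr A → Set where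
  this  : {x : Elem A} → PosElem x → Occ (el x)
  inAnd : {φs : List (Expr A)} → Any Occ φs → Occ (and φs)
  inOr  : {φs : List (Expr A)} → Any Occ φs → Occ (or φs)

mutual
  occExpr : {A : Set} {H : Expr A} → Occ H → Expr A
  occExpr {H = el x} (this _) = el x
  occExpr (inAnd p) = occExprAny p
  occExpr (inOr p)  = occExprAny p

  occExprAny : {A : Set} {φs : List (Expr A)} → Any Occ φs → Expr A
  occExprAny (here p)  = occExpr p
  occExprAny (there p) = occExprAny p

mutual
  Δ : {A : Set} (H : Expr A) → Occ H → Expr A
  Δ (el x)   (this _)  = el bot
  Δ (and φs) (inAnd p) = ΔAnd φs p
  Δ (or φs)  (inOr p)  = or (ΔOr φs p)

  ΔAnd : {A : Set} (φs : List (Expr A)) → Any Occ φs → Expr A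
  ΔAnd (φ ∷ φs) (here p)  = Δ φ p
  ΔAnd (φ ∷ φs) (there p) = ΔAnd φs p

  ΔOr : {A : Set} (φs : List (Expr A)) → Any Occ φs → List (Expr A)
  ΔOr (φ ∷ φs) (here p)  = Δ φ p ∷ φs
  ΔOr (φ ∷ φs) (there p) = φ ∷ ΔOr φs p

{-# OPTIONS --safe #-}
module Submission where

open import Defs
open import Data.List using (List; _∷_; [])
open import Data.List.Relation.Unary.Any using (Any; here; there)
open import Data.Product using (_,_)
open import Data.Sum using (_⊎_; inj₁; inj₂; map₂)

-- Below a conjunction, the conjunct containing h is
-- satisfied and Δ keeps only that conjunct. Below a disjunction, either the
-- disjunct containing h is satisfied (recurse), or another one is, and that
-- one survives unchanged in Δ.
module _ {A : Set} (I J : Interp A) where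

  mutual
    sat-reduct-occ⊎Δ : (H : Expr A) (h : Occ H) → Sat J (reduct I H) →
                       Sat J (reduct I (occExpr h)) ⊎ Sat J (reduct I (Δ H h))
    sat-reduct-occ⊎Δ (el x)   (this _)  s = inj₁ s
    sat-reduct-occ⊎Δ (and φs) (inAnd p) s = satAll-reduct-occ⊎ΔAnd φs p s
    sat-reduct-occ⊎Δ (or φs)  (inOr p)  s = satAny-reduct-occ⊎ΔOr φs p s

    satAll-reduct-occ⊎ΔAnd : (φs : List (Expr A)) (p : Any Occ φs) →
                             SatAll J (reductList I φs) →
                             Sat J (reduct I (occExprAny p)) ⊎ Sat J (reduct I (ΔAnd φs p))
    satAll-reduct-occ⊎ΔAnd (φ ∷ φs) (here p)  (sφ , _)  = sat-reduct-occ⊎Δ φ p sφ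
    satAll-reduct-occ⊎ΔAnd (φ ∷ φs) (there p) (_ , sφs) = satAll-reduct-occ⊎ΔAnd φs p sφs

    satAny-reduct-occ⊎ΔOr : (φs : List (Expr A)) (p : Any Occ φs) →
                            SatAny J (reductList I φs) →
                            Sat J (reduct I (occExprAny p)) ⊎ SatAny J (reductList I (ΔOr φs p))
    satAny-reduct-occ⊎ΔOr (φ ∷ φs) (here p)  (inj₁ sφ)  = map₂ inj₁ (sat-reduct-occ⊎Δ φ p sφ)
    satAny-reduct-occ⊎ΔOr (φ ∷ φs) (here p)  (inj₂ sφs) = inj₂ (inj₂ sφs)
    satAny-reduct-occ⊎ΔOr (φ ∷ φs) (there p) (inj₁ sφ)  = inj₂ (inj₁ sφ)
    satAny-reduct-occ⊎ΔOr (φ ∷ φs) (there p) (inj₂ sφs) = map₂ inj₂ (satAny-reduct-occ⊎ΔOr φs p sφs)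

theorem2 : {A : Set} (H : Expr A) → HornPos H → (h : Occ H) → (I : Interp A) →
    reduct I H ⊨ reduct I (or (occExpr h ∷ Δ H h ∷ []))
theorem2 H _ h I J sH = map₂ inj₁ (sat-reduct-occ⊎Δ I J H h sH)
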